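{- A finite graded poset $P$ is both $(3+1)$-avoiding and $(2+2)$-avoiding if and only if: (1) $P$ grade-avoids $2[0]+2[0]$, i.e., there are no two elements $a,c$ of some rank $i$ and two elements $b,d$ of rank $i+1$ with $a<b$, $c<d$, $a\not<d$, $c\not<b$; (2) every vertex of $P$ is up-seeing or down-seeing (or both); (3) every rank of $P$ contains at least one all-seeing vertex.
   Context: A finite poset is graded if all maximal chains have the same number of elements; then each element has a rank (minimal elements rank $0$, covering increases rank by $1$), and $P(i)$ is the set of elements of rank $i$. $P$ contains $(a_1+\cdots+a_m)$ if there are pairwise disjoint chains $C_1,\dots,C_m$ with $|C_i|=a_i$ such that elements in different chains are incomparable; otherwise it avoids it. For $p\in P(i)$, $US(p)$ is the set of elements covering $p$ and $DS(p)$ the set of elements covered by $p$; $p$ is up-seeing if $US(p)=P(i+1)$, down-seeing if $DS(p)=P(i-1)$ (with $P(j)=\emptyset$ for ranks outside the range), and all-seeing if both. -}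

module Defs where

open import Data.Nat using (ℕ; zero; suc)
open import Data.Fin using (Fin)
import Data.Fin as F
open import Data.Product using (Σ; ∃; ∃-syntax; _×_; _,_)
open import Data.Empty using (⊥)
open import Data.Sum using (_⊎_)
open import Relation.Nullary using (¬_)
open import Relation.Binary.PropositionalEquality using (_≡_; _≢_)
open import Relation.Binary.Definitions using (Decidable)
open import Relation.Binary.Structures using (IsPartialOrder)
open import Function.Bundles using (_⇔_)

record FinPoset : Set₁ where
  field
    n : ℕ
    _≤_ : Fin n → Fin n → Set
    isPartialOrder : IsPartialOrder _≡_ _≤_
    _≤?_ : Decidable _≤_

module _ (P : FinPoset) where
  open FinPoset P

  _<_ : Fin n → Fin n → Set
  p < q = (p ≤ q) × (p ≢ q)

  Incomparable : Fin n → Fin n → Set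
  Incomparable p q = ¬ (p ≤ q) × ¬ (q ≤ p)

  Covers : Fin n → Fin n → Set
  Covers p q = (p < q) × ¬ (∃[ r ] ((p < r) × (r < q)))

  Minimal : Fin n → Set
  Minimal p = ¬ (∃[ q ] (q < p))

  Chain : ℕ → Set
  Chain k = Σ (Fin k → Fin n) λ c → ∀ i j → i F.< j → c i < c j

  _⊆ᶜ_ : ∀ {k m} → Chain k → Chain m → Set
  (c , _) ⊆ᶜ (d , _) = ∀ i → ∃[ j ] (d j ≡ c i)

  MaximalChain : ∀ {k} → Chain k → Set
  MaximalChain C = ∀ m (D : Chain m) → C ⊆ᶜ D → D ⊆ᶜ C

  Graded : Set
  Graded = ∀ k m (C : Chain k) (D : Chain m) → MaximalChain C → MaximalChain D → k ≡ m

  -- P contains (a+b): two disjoint chains of sizes a, b whose elements are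
  -- pairwise incomparable across chains.
  Contains₂ : ℕ → ℕ → Set
  Contains₂ a b = Σ (Chain a) λ C → Σ (Chain b) λ D →
    ∀ i j → (Data.Product.proj₁ C i ≢ Data.Product.proj₁ D j)
          × Incomparable (Data.Product.proj₁ C i) (Data.Product.proj₁ D j)

  Avoids₂ : ℕ → ℕ → Set
  Avoids₂ a b = ¬ Contains₂ a b

  data HasRank : Fin n → ℕ → Set where
    rank-min  : ∀ {p} → Minimal p → HasRank p 0
    rank-step : ∀ {p q i} → HasRank p i → Covers p q → HasRank q (suc i)

  InPrevRank : ℕ → Fin n → Set
  InPrevRank zero    q = ⊥
  InPrevRank (suc i) q = HasRank q i

  UpSeeing : Fin n → Set
  UpSeeing p = ∀ i → HasRank p i → ∀ q → (Covers p q ⇔ HasRank q (suc i))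

  DownSeeing : Fin n → Set
  DownSeeing p = ∀ i → HasRank p i → ∀ q → (Covers q p ⇔ InPrevRank i q)

  AllSeeing : Fin n → Set
  AllSeeing p = UpSeeing p × DownSeeing p

  GradeAvoids2020 : Set
  GradeAvoids2020 = ¬ (∃[ i ] ∃[ a ] ∃[ c ] ∃[ b ] ∃[ d ]
    (HasRank a i × HasRank c i × HasRank b (suc i) × HasRank d (suc i)
     × (a < b) × (c < d) × ¬ (a < d) × ¬ (c < b)))

  EveryVertexUpOrDown : Set
  EveryVertexUpOrDown = ∀ p → UpSeeing p ⊎ DownSeeing p

  EveryRankHasAllSeeing : Set
  EveryRankHasAllSeeing = ∀ i → (∃[ p ] HasRank p i) → ∃[ p ] (HasRank p i × AllSeeing p)

-- In a graded poset, p < q with rank q = 1 + rank p means that q covers p, so both avoidance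
-- conditions become statements about adjacent ranks.  If P avoids (2+2), then any two elements two
-- ranks apart are comparable, and the up-shadows (elements of the next rank above) of the elements of
-- one rank are totally ordered by inclusion, as are the down-shadows: a crossing pair would be a
-- graded 2[0]+2[0].  An element covering one of least up-shadow and below one of least down-shadow
-- is then all-seeing, and a vertex that is neither up- nor down-seeing produces a (3+1) or a (2+2).
-- Conversely, all-seeing vertices make elements two ranks apart comparable.  This squeezes the ranks:
-- the single element of a (3+1) sits exactly one rank above the bottom and one below the top of the
-- 3-chain, so it can be neither up- nor down-seeing, and a (2+2) lies on two adjacent ranks, where it
-- is a graded 2[0]+2[0].
module Submission where

open import Defs hiding (_<_)
open import Data.Empty using (⊥; ⊥-elim)
open import Data.Fin as Fin using (Fin)
import Data.Fin.Properties as Fin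
open import Data.Fin.Induction using (po-wellFounded; po-noetherian)
open import Data.List using (List; allFin)
open import Data.List.Membership.Propositional using (_∈_)
open import Data.List.Membership.Propositional.Properties using (∈-allFin)
open import Data.List.Relation.Unary.Any using (here; there)
open import Data.Nat as ℕ using (ℕ; zero; suc; _+_; s≤s)
import Data.Nat.Properties as ℕ
open import Data.Product using (∃; ∃₂; ∃-syntax; _×_; _,_; proj₁; proj₂)
open import Data.Sum using (_⊎_; inj₁; inj₂; [_,_])
open import Function using (_∘_; _on_; id)
open import Function.Bundles using (_⇔_; mk⇔; Equivalence)
open import Induction.WellFounded using (Acc; acc)
open import Level using (Level; 0ℓ)
open import Relation.Binary.Definitions using (Transitive; Reflexive; tri<; tri≈; tri>)
open import Relation.Binary.PropositionalEquality using (_≡_; _≢_; refl; sym; trans; cong; subst)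
open import Relation.Binary.Structures using (IsPartialOrder)
import Relation.Binary.Construct.NonStrictToStrict as NonStrictToStrict
open import Relation.Nullary using (¬_; Dec; yes; no)
open import Relation.Nullary.Decidable using (_×-dec_; _→-dec_; decidable-stable)
open import Relation.Unary using (Pred; Decidable; _⊆_)

module _ {m : ℕ} {ℓ : Level} where

  all-or-counterexample : {A B : Pred (Fin m) ℓ} → Decidable A → Decidable B →
                          (∀ x → A x → B x) ⊎ ∃[ x ] (A x × ¬ B x)
  all-or-counterexample {A} {B} A? B? with Fin.all? (λ x → A? x →-dec B? x)
  ... | yes A⊆B = inj₁ A⊆B
  ... | no ¬A⊆B with Fin.¬∀⟶∃¬ m (λ x → A x → B x) (λ x → A? x →-dec B? x) ¬A⊆B
  ...   | x , ¬Ax⇒Bx with A? x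
  ...     | yes Ax = inj₂ (x , Ax , λ Bx → ¬Ax⇒Bx (λ _ → Bx))
  ...     | no ¬Ax = ⊥-elim (¬Ax⇒Bx (⊥-elim ∘ ¬Ax))

  ⊆-total-of-noncrossing : {A B : Pred (Fin m) ℓ} → Decidable A → Decidable B →
                           (∀ {x y} → A x → B y → ¬ B x → A y) → A ⊆ B ⊎ B ⊆ A
  ⊆-total-of-noncrossing A? B? noncrossing with all-or-counterexample A? B?
  ... | inj₁ A⊆B = inj₁ (A⊆B _)
  ... | inj₂ (x , Ax , ¬Bx) = inj₂ λ By → noncrossing Ax By ¬Bx

  least-element : {S : Pred (Fin m) ℓ} {_≼_ : Fin m → Fin m → Set ℓ} → Decidable S →
                  Reflexive _≼_ → Transitive _≼_ → (∀ {a b} → S a → S b → a ≼ b ⊎ b ≼ a) →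
                  ∃ S → ∃[ a ] (S a × ∀ {b} → S b → a ≼ b)
  least-element {S} {_≼_} S? ≼-refl ≼-trans total (c , Sc) with least-in (allFin m)
    where
    least-in : (xs : List (Fin m)) → ∃[ a ] (S a × ∀ {b} → b ∈ xs → S b → a ≼ b)
    least-in List.[] = c , Sc , λ ()
    least-in (y List.∷ ys) with least-in ys
    ... | a , Sa , a≼ys with S? y
    ...   | no ¬Sy = a , Sa , λ { (here refl) Sy → ⊥-elim (¬Sy Sy) ; (there b∈ys) → a≼ys b∈ys }
    ...   | yes Sy with total Sa Sy
    ...     | inj₁ a≼y = a , Sa , λ { (here refl) _ → a≼y ; (there b∈ys) → a≼ys b∈ys }
    ...     | inj₂ y≼a = y , Sy , λ { (here refl) _ → ≼-refl
                                  ; (there b∈ys) Sb → ≼-trans y≼a (a≼ys b∈ys Sb) }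
  ... | a , Sa , a≼all = a , Sa , a≼all (∈-allFin _)

<-of-≡suc : ∀ {m n i} → m ≡ i → n ≡ suc i → m ℕ.< n
<-of-≡suc refl refl = ℕ.n<1+n _

<-of-≡2+ : ∀ {m n i} → m ≡ i → n ≡ 2 + i → m ℕ.< n
<-of-≡2+ refl refl = ℕ.m<n+m _ (s≤s ℕ.z≤n)

module Poset (P : FinPoset) where
  open FinPoset P public
  open IsPartialOrder isPartialOrder public
    using (antisym) renaming (refl to ≤-refl; trans to ≤-trans; reflexive to ≤-reflexive)
  private
    module Strict = NonStrictToStrict _≡_ _≤_

  _<_ : Fin n → Fin n → Set
  _<_ = Defs._<_ P

  <-trans : ∀ {x y z} → x < y → y < z → x < z
  <-trans = Strict.<-trans isPartialOrder

  <-≤-trans : ∀ {x y z} → x < y → y ≤ z → x < z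
  <-≤-trans = Strict.<-≤-trans sym ≤-trans antisym (λ { refl x≤y → x≤y })

  _<?_ : ∀ x y → Dec (x < y)
  _<?_ = Strict.<-decidable Fin._≟_ _≤?_

  ≤⇒≡⊎< : ∀ {x y} → x ≤ y → x ≡ y ⊎ x < y
  ≤⇒≡⊎< {x} {y} x≤y with x Fin.≟ y
  ... | yes x≡y = inj₁ x≡y
  ... | no x≢y = inj₂ (x≤y , x≢y)

  Maximal : Fin n → Set
  Maximal x = ¬ (∃[ y ] (x < y))

  minimal-≤ : ∀ {a x} → Minimal P a → x ≤ a → a ≤ x
  minimal-≤ min-a x≤a with ≤⇒≡⊎< x≤a
  ... | inj₁ x≡a = ≤-reflexive (sym x≡a)
  ... | inj₂ x<a = ⊥-elim (min-a (_ , x<a))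

  incomparable : ∀ {x y} → x ≢ y → ¬ x < y → ¬ y < x → Incomparable P x y
  incomparable x≢y x≮y y≮x = [ x≢y , x≮y ] ∘ ≤⇒≡⊎< , [ x≢y ∘ sym , y≮x ] ∘ ≤⇒≡⊎<

  incomparable-sym : ∀ {x y} → Incomparable P x y → Incomparable P y x
  incomparable-sym (x≰y , y≰x) = y≰x , x≰y

  incomparable⇒≢ : ∀ {x y} → Incomparable P x y → x ≢ y
  incomparable⇒≢ (x≰y , _) = x≰y ∘ ≤-reflexive

  cover-below : ∀ {p q} → p < q → ∃[ r ] (p ≤ r × Covers P r q)
  cover-below {p} {q} = go p (po-noetherian isPartialOrder p)
    where
    go : ∀ p → Acc (λ x y → y < x) p → p < q → ∃[ r ] (p ≤ r × Covers P r q)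
    go p (acc rec) p<q with Fin.any? (λ r → (p <? r) ×-dec (r <? q))
    ... | no nothing-between = p , ≤-refl , p<q , nothing-between
    ... | yes (r , p<r , r<q) with go r (rec p<r) r<q
    ...   | s , r≤s , s⋖q = s , ≤-trans (proj₁ p<r) r≤s , s⋖q

  data Path (R : Fin n → Fin n → Set) : Fin n → Fin n → ℕ → Set where
    [] : ∀ {a} → Path R a a 0
    _∷_ : ∀ {a b c k} → R a b → Path R b c k → Path R a c (suc k)

  Saturated : Fin n → Fin n → ℕ → Set
  Saturated = Path (Covers P)

  module _ {R : Fin n → Fin n → Set} where

    _∷ʳ_ : ∀ {a b c k} → Path R a b k → R b c → Path R a c (suc k)
    [] ∷ʳ r = r ∷ []
    (r′ ∷ u) ∷ʳ r = r′ ∷ (u ∷ʳ r)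

    _++_ : ∀ {a b c i k} → Path R a b i → Path R b c k → Path R a c (i + k)
    [] ++ v = v
    (r ∷ u) ++ v = r ∷ (u ++ v)

    vertex : ∀ {a b k} → Path R a b k → Fin (suc k) → Fin n
    vertex {a} _ Fin.zero = a
    vertex (_ ∷ u) (Fin.suc i) = vertex u i

    module _ (R⇒< : ∀ {x y} → R x y → x < y) where

      start≤vertex : ∀ {a b k} (u : Path R a b k) i → a ≤ vertex u i
      start≤vertex _ Fin.zero = ≤-refl
      start≤vertex (r ∷ u) (Fin.suc i) = proj₁ (<-≤-trans (R⇒< r) (start≤vertex u i))

      start≤end : ∀ {a b k} → Path R a b k → a ≤ b
      start≤end [] = ≤-refl
      start≤end (r ∷ u) = proj₁ (<-≤-trans (R⇒< r) (start≤end u))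

      vertex-increasing : ∀ {a b k} (u : Path R a b k) i j → i Fin.< j → vertex u i < vertex u j
      vertex-increasing (r ∷ u) Fin.zero (Fin.suc j) _ = <-≤-trans (R⇒< r) (start≤vertex u j)
      vertex-increasing (r ∷ u) (Fin.suc i) (Fin.suc j) (s≤s i<j) = vertex-increasing u i j i<j
      vertex-increasing _ Fin.zero Fin.zero ()
      vertex-increasing _ (Fin.suc _) Fin.zero ()

      pathChain : ∀ {a b k} → Path R a b k → Chain P (suc k)
      pathChain u = vertex u , vertex-increasing u

  saturate : ∀ {p q} → p < q → ∃[ k ] Saturated p q (suc k)
  saturate {p} {q} = go q (po-wellFounded isPartialOrder q)
    where
    go : ∀ q → Acc _<_ q → p < q → ∃[ k ] Saturated p q (suc k)
    go q (acc rec) p<q with cover-below p<q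
    ... | r , p≤r , r⋖q with ≤⇒≡⊎< p≤r
    ...   | inj₁ refl = 0 , r⋖q ∷ []
    ...   | inj₂ p<r with go r (rec (proj₁ r⋖q)) p<r
    ...     | k , u = suc k , u ∷ʳ r⋖q

  cover-above : ∀ {p q} → p < q → ∃[ t ] (Covers P p t × t ≤ q)
  cover-above p<q with saturate p<q
  ... | _ , p⋖t ∷ u = _ , p⋖t , start≤end proj₁ u

  extend-to-maximal : ∀ p → ∃₂ λ k t → Maximal t × Saturated p t k
  extend-to-maximal p = go p (po-noetherian isPartialOrder p)
    where
    go : ∀ p → Acc (λ x y → y < x) p → ∃₂ λ k t → Maximal t × Saturated p t k
    go p (acc rec) with Fin.any? (p <?_)
    ... | no max-p = 0 , p , max-p , []
    ... | yes (_ , p<y) with cover-above p<y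
    ...   | r , p⋖r , _ with go r (rec (proj₁ p⋖r))
    ...     | k , t , max-t , u = suc k , t , max-t , p⋖r ∷ u

  Comparable : Fin n → Fin n → Set
  Comparable x y = x ≤ y ⊎ y ≤ x

  chain-comparable : ∀ {k} (C : Chain P k) i j → Comparable (proj₁ C i) (proj₁ C j)
  chain-comparable (c , c-increasing) i j with Fin.<-cmp i j
  ... | tri< i<j _ _ = inj₁ (proj₁ (c-increasing i j i<j))
  ... | tri≈ _ refl _ = inj₁ ≤-refl
  ... | tri> _ _ j<i = inj₂ (proj₁ (c-increasing j i j<i))

  on-saturated : ∀ {a b k x} (u : Saturated a b k) → Maximal b → a ≤ x →
                 (∀ i → Comparable (vertex u i) x) → ∃[ i ] (vertex u i ≡ x)
  on-saturated u max-b a≤x comparable with ≤⇒≡⊎< a≤x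
  ... | inj₁ a≡x = Fin.zero , a≡x
  on-saturated [] max-b _ _ | inj₂ a<x = ⊥-elim (max-b (_ , a<x))
  on-saturated {x = x} (a⋖b ∷ u) max-b _ comparable | inj₂ a<x
    with on-saturated u max-b b≤x (comparable ∘ Fin.suc)
    where
    b≤x : vertex u Fin.zero ≤ x
    b≤x with comparable (Fin.suc Fin.zero)
    ... | inj₁ b≤x = b≤x
    ... | inj₂ x≤b with ≤⇒≡⊎< x≤b
    ...   | inj₁ x≡b = ≤-reflexive (sym x≡b)
    ...   | inj₂ x<b = ⊥-elim (proj₂ a⋖b (x , a<x , x<b))
  ... | i , vertex≡x = Fin.suc i , vertex≡x

  saturated-maximalChain : ∀ {a b k} → Minimal P a → Maximal b → (u : Saturated a b k) →
                           MaximalChain P (pathChain proj₁ u)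
  saturated-maximalChain {a} min-a max-b u m (d , d-increasing) C⊆D j =
    on-saturated u max-b a≤dj dj-comparable
    where
    D : Chain P m
    D = d , d-increasing
    a≤dj : a ≤ d j
    a≤dj with C⊆D Fin.zero
    ... | j₀ , dj₀≡a = [ subst (_≤ d j) dj₀≡a , minimal-≤ min-a ∘ subst (d j ≤_) dj₀≡a ]
                         (chain-comparable D j₀ j)
    dj-comparable : ∀ i → Comparable (vertex u i) (d j)
    dj-comparable i with C⊆D i
    ... | j′ , dj′≡ui = subst (λ z → Comparable z (d j)) dj′≡ui (chain-comparable D j′ j)

  chain₁ : Fin n → Chain P 1
  chain₁ x = pathChain id ([] {a = x})

  chain₂ : ∀ {a b} → a < b → Chain P 2
  chain₂ a<b = pathChain id (a<b ∷ [])

  chain₃ : ∀ {a b c} → a < b → b < c → Chain P 3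
  chain₃ a<b b<c = pathChain id (a<b ∷ (b<c ∷ []))

  separated : ∀ {x y} → Incomparable P x y → (x ≢ y) × Incomparable P x y
  separated x∥y = incomparable⇒≢ x∥y , x∥y

  contains-2+2 : ∀ {a b c d} (a<b : a < b) (c<d : c < d) →
                 Incomparable P a c → Incomparable P a d → Incomparable P b c → Incomparable P b d →
                 Contains₂ P 2 2
  contains-2+2 a<b c<d a∥c a∥d b∥c b∥d = chain₂ a<b , chain₂ c<d , separation
    where
    separation : ∀ i j → let x = proj₁ (chain₂ a<b) i ; y = proj₁ (chain₂ c<d) j in
                 (x ≢ y) × Incomparable P x y
    separation Fin.zero Fin.zero = separated a∥c
    separation Fin.zero (Fin.suc Fin.zero) = separated a∥d
    separation (Fin.suc Fin.zero) Fin.zero = separated b∥c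
    separation (Fin.suc Fin.zero) (Fin.suc Fin.zero) = separated b∥d

  contains-3+1 : ∀ {a b c x} (a<b : a < b) (b<c : b < c) →
                 Incomparable P a x → Incomparable P b x → Incomparable P c x → Contains₂ P 3 1
  contains-3+1 {x = x} a<b b<c a∥x b∥x c∥x = chain₃ a<b b<c , chain₁ x , separation
    where
    separation : ∀ i j → let y = proj₁ (chain₃ a<b b<c) i ; z = proj₁ (chain₁ x) j in
                 (y ≢ z) × Incomparable P y z
    separation Fin.zero Fin.zero = separated a∥x
    separation (Fin.suc Fin.zero) Fin.zero = separated b∥x
    separation (Fin.suc (Fin.suc Fin.zero)) Fin.zero = separated c∥x

module GradedPoset (P : FinPoset) (graded : Graded P) where
  open Poset P

  saturated-lengths-agree : ∀ {a b k a′ b′ k′} →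
    Minimal P a → Maximal b → Saturated a b k →
    Minimal P a′ → Maximal b′ → Saturated a′ b′ k′ → k ≡ k′
  saturated-lengths-agree min-a max-b u min-a′ max-b′ u′ = ℕ.suc-injective
    (graded _ _ (pathChain proj₁ u) (pathChain proj₁ u′)
      (saturated-maximalChain min-a max-b u) (saturated-maximalChain min-a′ max-b′ u′))

  from-minimal : ∀ {p i} → HasRank P p i → ∃[ a ] (Minimal P a × Saturated a p i)
  from-minimal (rank-min min-p) = _ , min-p , []
  from-minimal (rank-step h q⋖p) with from-minimal h
  ... | a , min-a , u = a , min-a , u ∷ʳ q⋖p

  hasRank-along : ∀ {a b j k} → HasRank P a j → Saturated a b k → HasRank P b (k + j)
  hasRank-along h [] = h
  hasRank-along {b = b} {j} {suc k} h (a⋖a′ ∷ u) =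
    subst (HasRank P b) (ℕ.+-suc k j) (hasRank-along (rank-step h a⋖a′) u)

  hasRank-unique : ∀ {p i j} → HasRank P p i → HasRank P p j → i ≡ j
  hasRank-unique {p} {i} {j} hᵢ hⱼ with from-minimal hᵢ | from-minimal hⱼ | extend-to-maximal p
  ... | _ , min-a , u | _ , min-a′ , u′ | k , _ , max-t , v =
    ℕ.+-cancelʳ-≡ k i j (saturated-lengths-agree min-a max-t (u ++ v) min-a′ max-t (u′ ++ v))

  hasSomeRank : ∀ p → ∃ (HasRank P p)
  hasSomeRank p = go p (po-wellFounded isPartialOrder p)
    where
    go : ∀ p → Acc _<_ p → ∃ (HasRank P p)
    go p (acc rec) with Fin.any? (_<? p)
    ... | no min-p = 0 , rank-min min-p
    ... | yes (_ , q<p) with cover-below q<p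
    ...   | r , _ , r⋖p with go r (rec (proj₁ r⋖p))
    ...     | i , hᵣ = suc i , rank-step hᵣ r⋖p

  rank : Fin n → ℕ
  rank p = proj₁ (hasSomeRank p)

  hasRank-rank : ∀ p → HasRank P p (rank p)
  hasRank-rank p = proj₂ (hasSomeRank p)

  rank-unique : ∀ {p i} → HasRank P p i → rank p ≡ i
  rank-unique = hasRank-unique (hasRank-rank _)

  rank≡⇒hasRank : ∀ {p i} → rank p ≡ i → HasRank P p i
  rank≡⇒hasRank {p} eq = subst (HasRank P p) eq (hasRank-rank p)

  rank-along : ∀ {a b k} → Saturated a b k → rank b ≡ k + rank a
  rank-along u = rank-unique (hasRank-along (hasRank-rank _) u)

  rank-< : ∀ {a b} → a < b → rank a ℕ.< rank b
  rank-< {a} a<b with saturate a<b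
  ... | k , u rewrite rank-along u = s≤s (ℕ.m≤n+m (rank a) k)

  rank-≤⇒≯ : ∀ {x y} → rank x ℕ.≤ rank y → ¬ y < x
  rank-≤⇒≯ rx≤ry y<x = ℕ.<⇒≱ (rank-< y<x) rx≤ry

  rank-<⇒≢ : ∀ {x y} → rank x ℕ.< rank y → x ≢ y
  rank-<⇒≢ rx<ry = ℕ.<⇒≢ rx<ry ∘ cong rank

  rank-maximal : ∀ {x y} → Maximal x → rank y ℕ.≤ rank x
  rank-maximal {x} {y} max-x
    with from-minimal (hasRank-rank x) | from-minimal (hasRank-rank y) | extend-to-maximal y
  ... | _ , min-a , u | _ , min-a′ , u′ | l , _ , max-t , v =
    subst (rank y ℕ.≤_) (saturated-lengths-agree min-a′ max-t (u′ ++ v) min-a max-x u)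
          (ℕ.m≤m+n (rank y) l)

  covers⇒rank-suc : ∀ {p q} → Covers P p q → rank q ≡ suc (rank p)
  covers⇒rank-suc p⋖q = rank-unique (rank-step (hasRank-rank _) p⋖q)

  adjacent⇒covers : ∀ {p q} → p < q → rank q ≡ suc (rank p) → Covers P p q
  adjacent⇒covers {p} {q} p<q rq≡ = p<q , λ { (r , p<r , r<q) →
    ℕ.<⇒≱ (rank-< p<r) (ℕ.≤-pred (subst (rank r ℕ.<_) rq≡ (rank-< r<q))) }

  lower-cover : ∀ {q i} → rank q ≡ suc i → ∃[ u ] (rank u ≡ i × Covers P u q)
  lower-cover rq≡ with rank≡⇒hasRank rq≡
  ... | rank-step hᵤ u⋖q = _ , rank-unique hᵤ , u⋖q

  upper-cover : ∀ {x y} → rank x ℕ.< rank y → ∃ (Covers P x)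
  upper-cover {x} rx<ry with Fin.any? (x <?_)
  ... | yes (_ , x<z) = let (t , x⋖t , _) = cover-above x<z in t , x⋖t
  ... | no max-x = ⊥-elim (ℕ.<⇒≱ rx<ry (rank-maximal max-x))

  incomparable-rank-< : ∀ {x y} → rank x ℕ.< rank y → ¬ x < y → Incomparable P x y
  incomparable-rank-< rx<ry x≮y = incomparable (rank-<⇒≢ rx<ry) x≮y (rank-≤⇒≯ (ℕ.<⇒≤ rx<ry))

  incomparable-same-rank : ∀ {x y} → rank x ≡ rank y → x ≢ y → Incomparable P x y
  incomparable-same-rank rx≡ry x≢y =
    incomparable x≢y (rank-≤⇒≯ (ℕ.≤-reflexive (sym rx≡ry))) (rank-≤⇒≯ (ℕ.≤-reflexive rx≡ry))

  SeesUp SeesDown : Fin n → Set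
  SeesUp p = ∀ q → rank q ≡ suc (rank p) → p < q
  SeesDown p = ∀ q → suc (rank q) ≡ rank p → q < p

  upSeeing⇔ : ∀ {p} → UpSeeing P p ⇔ SeesUp p
  upSeeing⇔ {p} = mk⇔
    (λ up q rq≡ → proj₁ (Equivalence.from (up _ (hasRank-rank p) q) (rank≡⇒hasRank rq≡)))
    (λ sees i hₚ q → seeing (rank-unique hₚ) hₚ q sees)
    where
    seeing : ∀ {i} → rank p ≡ i → HasRank P p i → ∀ q → SeesUp p →
             Covers P p q ⇔ HasRank P q (suc i)
    seeing refl hₚ q sees = mk⇔ (rank-step hₚ)
      (λ h → let rq≡ = rank-unique h in adjacent⇒covers (sees q rq≡) rq≡)

  inPrevRank⇒ : ∀ {q} i → InPrevRank P i q → suc (rank q) ≡ i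
  inPrevRank⇒ (suc i) h = cong suc (rank-unique h)

  ⇒inPrevRank : ∀ {q i} → suc (rank q) ≡ i → InPrevRank P i q
  ⇒inPrevRank {q} refl = hasRank-rank q

  downSeeing⇔ : ∀ {p} → DownSeeing P p ⇔ SeesDown p
  downSeeing⇔ {p} = mk⇔
    (λ down q rq≡ → proj₁ (Equivalence.from (down _ (hasRank-rank p) q) (⇒inPrevRank rq≡)))
    (λ sees i hₚ q → seeing (rank-unique hₚ) q sees)
    where
    seeing : ∀ {i} → rank p ≡ i → ∀ q → SeesDown p → Covers P q p ⇔ InPrevRank P i q
    seeing refl q sees = mk⇔
      (λ q⋖p → ⇒inPrevRank (sym (covers⇒rank-suc q⋖p)))
      (λ h → let rq≡ = inPrevRank⇒ (rank p) h in adjacent⇒covers (sees q rq≡) (sym rq≡))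

  no-graded-2+2 : GradeAvoids2020 P → ∀ {a b c d} →
    rank c ≡ rank a → rank b ≡ suc (rank a) → rank d ≡ suc (rank a) →
    a < b → c < d → ¬ a < d → ¬ c < b → ⊥
  no-graded-2+2 avoid {a} rc≡ rb≡ rd≡ a<b c<d a≮d c≮b =
    avoid (rank a , _ , _ , _ , _ , hasRank-rank a , rank≡⇒hasRank rc≡ ,
           rank≡⇒hasRank rb≡ , rank≡⇒hasRank rd≡ , a<b , c<d , a≮d , c≮b)

  avoids2+2⇒gradeAvoids : Avoids₂ P 2 2 → GradeAvoids2020 P
  avoids2+2⇒gradeAvoids avoid (_ , a , c , b , d , ha , hc , hb , hd , a<b , c<d , a≮d , c≮b) =
    avoid (contains-2+2 a<b c<d a∥c a∥d b∥c b∥d)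
    where
    a∥c : Incomparable P a c
    a∥c = incomparable-same-rank (trans (rank-unique ha) (sym (rank-unique hc)))
            (λ a≡c → c≮b (subst (_< b) a≡c a<b))
    a∥d : Incomparable P a d
    a∥d = incomparable-rank-< (<-of-≡suc (rank-unique ha) (rank-unique hd)) a≮d
    b∥c : Incomparable P b c
    b∥c = incomparable-sym (incomparable-rank-< (<-of-≡suc (rank-unique hc) (rank-unique hb)) c≮b)
    b∥d : Incomparable P b d
    b∥d = incomparable-same-rank (trans (rank-unique hb) (sym (rank-unique hd)))
            (λ b≡d → a≮d (subst (a <_) b≡d a<b))

  TwoApartComparable : Set
  TwoApartComparable = ∀ {r q} → rank q ≡ 2 + rank r → r < q

  avoids2+2⇒twoApartComparable : Avoids₂ P 2 2 → TwoApartComparable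
  avoids2+2⇒twoApartComparable avoid {r} {q} rq≡ with r <? q
  ... | yes r<q = r<q
  ... | no r≮q with lower-cover rq≡ | upper-cover (<-of-≡2+ refl rq≡)
  ...   | u , ru≡ , u⋖q | t , r⋖t =
    ⊥-elim (avoid (contains-2+2 (proj₁ r⋖t) (proj₁ u⋖q) r∥u r∥q t∥u t∥q))
    where
    rt≡ : rank t ≡ suc (rank r)
    rt≡ = covers⇒rank-suc r⋖t
    r∥u : Incomparable P r u
    r∥u = incomparable-rank-< (<-of-≡suc refl ru≡) (λ r<u → r≮q (<-trans r<u (proj₁ u⋖q)))
    r∥q : Incomparable P r q
    r∥q = incomparable-rank-< (<-of-≡2+ refl rq≡) r≮q
    t∥u : Incomparable P t u
    t∥u = incomparable-same-rank (trans rt≡ (sym ru≡))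
            (λ t≡u → r≮q (<-trans (proj₁ r⋖t) (subst (_< q) (sym t≡u) (proj₁ u⋖q))))
    t∥q : Incomparable P t q
    t∥q = incomparable-rank-< (<-of-≡suc rt≡ rq≡) (λ t<q → r≮q (<-trans (proj₁ r⋖t) t<q))

  allSeeing⇒twoApartComparable : EveryRankHasAllSeeing P → TwoApartComparable
  allSeeing⇒twoApartComparable allSeeing {r} {q} rq≡ with lower-cover rq≡
  ... | y , ry≡ , _ with allSeeing (suc (rank r)) (y , rank≡⇒hasRank ry≡)
  ...   | w , hw , up , down =
    <-trans (Equivalence.to downSeeing⇔ down r (sym rw≡))
            (Equivalence.to upSeeing⇔ up q (trans rq≡ (cong suc (sym rw≡))))
    where
    rw≡ : rank w ≡ suc (rank r)
    rw≡ = rank-unique hw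

  apart-comparable : TwoApartComparable → ∀ {r q} → 2 + rank r ℕ.≤ rank q → r < q
  apart-comparable twoApart {r} {q} 2+r≤q = go (rank q ℕ.∸ (2 + rank r)) (sym (ℕ.m∸n+n≡m 2+r≤q))
    where
    go : ∀ k {q} → rank q ≡ k + (2 + rank r) → r < q
    go zero rq≡ = twoApart rq≡
    go (suc k) rq≡ with lower-cover rq≡
    ... | _ , ru≡ , u⋖q = <-trans (go k ru≡) (proj₁ u⋖q)

  incomparable⇒rank-≤ : TwoApartComparable → ∀ {x y} → Incomparable P x y → rank y ℕ.≤ suc (rank x)
  incomparable⇒rank-≤ twoApart {x} {y} (x≰y , _) with 2 + rank x ℕ.≤? rank y
  ... | yes 2+x≤y = ⊥-elim (x≰y (proj₁ (apart-comparable twoApart 2+x≤y)))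
  ... | no 2+x≰y = ℕ.≤-pred (ℕ.≰⇒> 2+x≰y)

  -- The would-be (2+2) is ruled out by two-apart comparability, so r < q and a cover of r below q
  -- completes a 3-chain beside p.
  neither-up-nor-down-contains : Avoids₂ P 2 2 → ∀ {p q r} →
    rank q ≡ suc (rank p) → ¬ p < q → suc (rank r) ≡ rank p → ¬ r < p → Contains₂ P 3 1
  neither-up-nor-down-contains avoid {p} {q} {r} rq≡ p≮q rr≡ r≮p
    with cover-above (avoids2+2⇒twoApartComparable avoid (trans rq≡ (cong suc (sym rr≡))))
  ... | t , r⋖t , t≤q = contains-3+1 (proj₁ r⋖t) t<q r∥p t∥p q∥p
    where
    rt≡ : rank t ≡ rank p
    rt≡ = trans (covers⇒rank-suc r⋖t) rr≡
    t<q : t < q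
    t<q = t≤q , rank-<⇒≢ (<-of-≡suc rt≡ rq≡)
    r∥p : Incomparable P r p
    r∥p = incomparable-rank-< (<-of-≡suc refl (sym rr≡)) r≮p
    t∥p : Incomparable P t p
    t∥p = incomparable-same-rank rt≡ (λ t≡p → r≮p (subst (r <_) t≡p (proj₁ r⋖t)))
    q∥p : Incomparable P q p
    q∥p = incomparable-sym (incomparable-rank-< (<-of-≡suc refl rq≡) p≮q)

  avoids⇒upOrDown : Avoids₂ P 3 1 → Avoids₂ P 2 2 → EveryVertexUpOrDown P
  avoids⇒upOrDown avoid₃₁ avoid₂₂ p
    with all-or-counterexample (λ q → rank q ℕ.≟ suc (rank p)) (p <?_)
       | all-or-counterexample (λ r → suc (rank r) ℕ.≟ rank p) (_<? p)
  ... | inj₁ sees-up | _ = inj₁ (Equivalence.from upSeeing⇔ sees-up)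
  ... | inj₂ _ | inj₁ sees-down = inj₂ (Equivalence.from downSeeing⇔ sees-down)
  ... | inj₂ (_ , rq≡ , p≮q) | inj₂ (_ , rr≡ , r≮p) =
    ⊥-elim (avoid₃₁ (neither-up-nor-down-contains avoid₂₂ rq≡ p≮q rr≡ r≮p))

  UpShadow DownShadow : Fin n → Pred (Fin n) 0ℓ
  UpShadow r x = rank x ≡ suc (rank r) × r < x
  DownShadow q x = suc (rank x) ≡ rank q × x < q

  upShadow? : ∀ r → Decidable (UpShadow r)
  upShadow? r x = (rank x ℕ.≟ suc (rank r)) ×-dec (r <? x)

  downShadow? : ∀ q → Decidable (DownShadow q)
  downShadow? q x = (suc (rank x) ℕ.≟ rank q) ×-dec (x <? q)

  upShadows-nested : GradeAvoids2020 P → ∀ {c r} → rank c ≡ rank r →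
                     UpShadow c ⊆ UpShadow r ⊎ UpShadow r ⊆ UpShadow c
  upShadows-nested avoid {c} {r} rc≡rr =
    ⊆-total-of-noncrossing (upShadow? c) (upShadow? r) noncrossing
    where
    noncrossing : ∀ {x y} → UpShadow c x → UpShadow r y → ¬ UpShadow r x → UpShadow c y
    noncrossing {x} {y} (rx≡ , c<x) (ry≡ , r<y) x∉Uᵣ = ry≡′ , decidable-stable (c <? y)
      (λ c≮y → no-graded-2+2 avoid (sym rc≡rr) rx≡ ry≡′ c<x r<y c≮y
                 (λ r<x → x∉Uᵣ (trans rx≡ (cong suc rc≡rr) , r<x)))
      where
      ry≡′ : rank y ≡ suc (rank c)
      ry≡′ = trans ry≡ (cong suc (sym rc≡rr))

  downShadows-nested : GradeAvoids2020 P → ∀ {c r} → rank c ≡ rank r →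
                       DownShadow c ⊆ DownShadow r ⊎ DownShadow r ⊆ DownShadow c
  downShadows-nested avoid {c} {r} rc≡rr =
    ⊆-total-of-noncrossing (downShadow? c) (downShadow? r) noncrossing
    where
    noncrossing : ∀ {x y} → DownShadow c x → DownShadow r y → ¬ DownShadow r x → DownShadow c y
    noncrossing {x} {y} (rx≡ , x<c) (ry≡ , y<r) x∉Dᵣ = ry≡′ , decidable-stable (y <? c)
      (λ y≮c → no-graded-2+2 avoid (ℕ.suc-injective (trans ry≡′ (sym rx≡))) (sym rx≡)
                 (sym (trans rx≡ rc≡rr)) x<c y<r (λ x<r → x∉Dᵣ (trans rx≡ rc≡rr , x<r)) y≮c)
      where
      ry≡′ : suc (rank y) ≡ rank c
      ry≡′ = trans ry≡ (sym rc≡rr)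

  LeastUpShadowAt LeastDownShadowAt : ℕ → Fin n → Set
  LeastUpShadowAt i r = rank r ≡ i × ∀ {x} → rank x ≡ i → UpShadow r ⊆ UpShadow x
  LeastDownShadowAt i q = rank q ≡ i × ∀ {x} → rank x ≡ i → DownShadow q ⊆ DownShadow x

  leastUpShadow-exists : GradeAvoids2020 P → ∀ {p i} → rank p ≡ i → ∃ (LeastUpShadowAt i)
  leastUpShadow-exists avoid {p} {i} rp≡ =
    least-element {_≼_ = _⊆_ on UpShadow} (λ x → rank x ℕ.≟ i) id (λ ⊆₁ ⊆₂ → ⊆₂ ∘ ⊆₁)
      (λ ra≡ rb≡ → upShadows-nested avoid (trans ra≡ (sym rb≡))) (p , rp≡)

  leastDownShadow-exists : GradeAvoids2020 P → ∀ {p i} → rank p ≡ i → ∃ (LeastDownShadowAt i)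
  leastDownShadow-exists avoid {p} {i} rp≡ =
    least-element {_≼_ = _⊆_ on DownShadow} (λ x → rank x ℕ.≟ i) id (λ ⊆₁ ⊆₂ → ⊆₂ ∘ ⊆₁)
      (λ ra≡ rb≡ → downShadows-nested avoid (trans ra≡ (sym rb≡))) (p , rp≡)

  cover-of-least-seesDown : ∀ {i r t} → LeastUpShadowAt i r → Covers P r t →
                            rank t ≡ suc i × SeesDown t
  cover-of-least-seesDown {r = r} {t} (rr≡ , least) r⋖t = trans rt≡ (cong suc rr≡) , sees
    where
    rt≡ : rank t ≡ suc (rank r)
    rt≡ = covers⇒rank-suc r⋖t
    sees : SeesDown t
    sees q rq≡ =
      proj₂ (least (ℕ.suc-injective (trans rq≡ (trans rt≡ (cong suc rr≡)))) (rt≡ , proj₁ r⋖t))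

  downShadow-of-least-seesUp : ∀ {i q u} → LeastDownShadowAt i q → DownShadow q u → SeesUp u
  downShadow-of-least-seesUp (rq≡ , least) (ru≡ , u<q) x rx≡ =
    proj₂ (least (trans rx≡ (trans ru≡ rq≡)) (ru≡ , u<q))

  seesDown-rank-zero : ∀ {u} → rank u ≡ 0 → SeesDown u
  seesDown-rank-zero ru≡0 _ rq≡ = ⊥-elim (ℕ.1+n≢0 (trans rq≡ ru≡0))

  seesDown-exists : GradeAvoids2020 P → ∀ i {p} → rank p ≡ i → ∃[ u ] (rank u ≡ i × SeesDown u)
  seesDown-exists avoid zero rp≡ = _ , rp≡ , seesDown-rank-zero rp≡
  seesDown-exists avoid (suc i) rp≡ with lower-cover rp≡
  ... | _ , rp′≡ , _ with leastUpShadow-exists avoid rp′≡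
  ...   | r , least with upper-cover {r} (<-of-≡suc (proj₁ least) rp≡)
  ...     | t , r⋖t = t , cover-of-least-seesDown least r⋖t

  seesDown-below : GradeAvoids2020 P → TwoApartComparable →
                   ∀ i {q} → rank q ≡ suc i → ∃[ u ] (rank u ≡ i × SeesDown u × u < q)
  seesDown-below avoid twoApart zero rq≡ with lower-cover rq≡
  ... | u , ru≡ , u⋖q = u , ru≡ , seesDown-rank-zero ru≡ , proj₁ u⋖q
  seesDown-below avoid twoApart (suc i) rq≡ with lower-cover rq≡
  ... | _ , rq′≡ , _ with lower-cover rq′≡
  ...   | _ , rp≡ , _ with leastUpShadow-exists avoid rp≡
  ...     | r , least with cover-above (twoApart (trans rq≡ (cong (2 +_) (sym (proj₁ least)))))
  ...       | t , r⋖t , t≤q with cover-of-least-seesDown least r⋖t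
  ...         | rt≡ , sees = t , rt≡ , sees , t≤q , rank-<⇒≢ (<-of-≡suc rt≡ rq≡)

  allSeeing-at : GradeAvoids2020 P → TwoApartComparable →
                 ∀ i {p} → rank p ≡ i → ∃[ u ] (rank u ≡ i × SeesUp u × SeesDown u)
  allSeeing-at avoid twoApart i rp≡ with Fin.any? (λ q → rank q ℕ.≟ suc i)
  ... | no top-rank with seesDown-exists avoid i rp≡
  ...   | u , ru≡ , down =
    u , ru≡ , (λ q rq≡ → ⊥-elim (top-rank (q , trans rq≡ (cong suc ru≡)))) , down
  allSeeing-at avoid twoApart i rp≡ | yes (_ , rq₀≡) with leastDownShadow-exists avoid rq₀≡
  ... | q , least with seesDown-below avoid twoApart i (proj₁ least)
  ...   | u , ru≡ , down , u<q =
    u , ru≡ , downShadow-of-least-seesUp least (trans (cong suc ru≡) (sym (proj₁ least)) , u<q) , down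

  avoids2+2⇒allSeeing : Avoids₂ P 2 2 → EveryRankHasAllSeeing P
  avoids2+2⇒allSeeing avoid i (_ , hₚ)
    with allSeeing-at (avoids2+2⇒gradeAvoids avoid) (avoids2+2⇒twoApartComparable avoid)
                      i (rank-unique hₚ)
  ... | u , ru≡ , up , down =
    u , rank≡⇒hasRank ru≡ , Equivalence.from upSeeing⇔ up , Equivalence.from downSeeing⇔ down

  upOrDown⇒avoids3+1 : EveryVertexUpOrDown P → TwoApartComparable → Avoids₂ P 3 1
  upOrDown⇒avoids3+1 upOrDown twoApart ((chain , increasing) , (single , _) , separation) =
    [ up-blind , down-blind ] (upOrDown x)
    where
    a c x : Fin n
    a = chain Fin.zero
    c = chain (Fin.suc (Fin.suc Fin.zero))
    x = single Fin.zero
    a∥x : Incomparable P a x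
    a∥x = proj₂ (separation Fin.zero Fin.zero)
    c∥x : Incomparable P c x
    c∥x = proj₂ (separation (Fin.suc (Fin.suc Fin.zero)) Fin.zero)
    2+a≤c : 2 + rank a ℕ.≤ rank c
    2+a≤c = ℕ.≤-trans (s≤s (rank-< (increasing _ (Fin.suc Fin.zero) (s≤s ℕ.z≤n))))
                      (rank-< (increasing (Fin.suc Fin.zero) _ (s≤s (s≤s ℕ.z≤n))))
    x≤1+a : rank x ℕ.≤ suc (rank a)
    x≤1+a = incomparable⇒rank-≤ twoApart a∥x
    c≤1+x : rank c ℕ.≤ suc (rank x)
    c≤1+x = incomparable⇒rank-≤ twoApart (incomparable-sym c∥x)
    up-blind : UpSeeing P x → ⊥
    up-blind up = proj₂ c∥x (proj₁ (Equivalence.to upSeeing⇔ up c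
      (ℕ.≤-antisym c≤1+x (ℕ.≤-trans (s≤s x≤1+a) 2+a≤c))))
    down-blind : DownSeeing P x → ⊥
    down-blind down = proj₁ a∥x (proj₁ (Equivalence.to downSeeing⇔ down a
      (ℕ.≤-antisym (ℕ.≤-pred (ℕ.≤-trans 2+a≤c c≤1+x)) x≤1+a)))

  gradeAvoids⇒avoids2+2 : GradeAvoids2020 P → TwoApartComparable → Avoids₂ P 2 2
  gradeAvoids⇒avoids2+2 avoid twoApart ((f , f-increasing) , (g , g-increasing) , separation) =
    no-graded-2+2 avoid c≡a b≡1+a d≡1+a a<b c<d (proj₁ a∥d ∘ proj₁) (proj₂ b∥c ∘ proj₁)
    where
    a b c d : Fin n
    a = f Fin.zero
    b = f (Fin.suc Fin.zero)
    c = g Fin.zero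
    d = g (Fin.suc Fin.zero)
    a<b : a < b
    a<b = f-increasing _ _ (s≤s ℕ.z≤n)
    c<d : c < d
    c<d = g-increasing _ _ (s≤s ℕ.z≤n)
    a∥d : Incomparable P a d
    a∥d = proj₂ (separation Fin.zero (Fin.suc Fin.zero))
    b∥c : Incomparable P b c
    b∥c = proj₂ (separation (Fin.suc Fin.zero) Fin.zero)
    1+a≤b : suc (rank a) ℕ.≤ rank b
    1+a≤b = rank-< a<b
    b≤1+c : rank b ℕ.≤ suc (rank c)
    b≤1+c = incomparable⇒rank-≤ twoApart (incomparable-sym b∥c)
    1+c≤d : suc (rank c) ℕ.≤ rank d
    1+c≤d = rank-< c<d
    d≤1+a : rank d ℕ.≤ suc (rank a)
    d≤1+a = incomparable⇒rank-≤ twoApart a∥d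
    b≡1+a : rank b ≡ suc (rank a)
    b≡1+a = ℕ.≤-antisym (ℕ.≤-trans b≤1+c (ℕ.≤-trans 1+c≤d d≤1+a)) 1+a≤b
    d≡1+a : rank d ≡ suc (rank a)
    d≡1+a = ℕ.≤-antisym d≤1+a (ℕ.≤-trans 1+a≤b (ℕ.≤-trans b≤1+c 1+c≤d))
    c≡a : rank c ≡ rank a
    c≡a = ℕ.suc-injective (ℕ.≤-antisym (ℕ.≤-trans 1+c≤d d≤1+a) (ℕ.≤-trans 1+a≤b b≤1+c))

theorem5p4 : (P : FinPoset) → Graded P →
    ((Avoids₂ P 3 1 × Avoids₂ P 2 2) ⇔
     (GradeAvoids2020 P × EveryVertexUpOrDown P × EveryRankHasAllSeeing P))
theorem5p4 P graded = mk⇔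
  (λ (avoid₃₁ , avoid₂₂) →
     avoids2+2⇒gradeAvoids avoid₂₂ ,
     avoids⇒upOrDown avoid₃₁ avoid₂₂ ,
     avoids2+2⇒allSeeing avoid₂₂)
  (λ (avoid , upOrDown , allSeeing) →
     let twoApart = allSeeing⇒twoApartComparable allSeeing
     in upOrDown⇒avoids3+1 upOrDown twoApart , gradeAvoids⇒avoids2+2 avoid twoApart)
  where open GradedPoset P graded
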